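{- Let $D$ be a minimal strong digraph, let $C_q$ be a directed cycle of length $q\ge 2$ contained in $D$, and let $D'$ be the digraph obtained from $D$ by deleting all arcs of $C_q$. Let $S_1, S_2$ be two strong components of $D'$, each containing vertices of $C_q$, which are cut, i.e. there are vertices $u_1,u_2\in S_1$ and $v_1,v_2\in S_2$ on $C_q$ appearing in the cyclic order $u_1,\dots,v_1,\dots,u_2,\dots,v_2,\dots,u_1$ along $C_q$. Then there is no pair of consecutive vertices of $C_q$ with one in $S_1$ and the other in $S_2$.
   Context: An arc $uv$ of a digraph is transitive if there is another directed $uv$-path not using the arc $uv$. A minimal strong digraph is a strongly connected digraph with no transitive arcs. A strong component is a maximal strongly connected subdigraph. Two vertices of $C_q$ are consecutive if they are joined by an arc of $C_q$. -}

module Defs where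

open import Data.Nat as ℕ using (ℕ; zero; suc)
open import Data.Fin as Fin using (Fin; zero; suc; toℕ; lower₁; _<_)
open import Data.Bool using (Bool; true; false)
open import Data.Product using (Σ; ∃; _×_; _,_)
open import Data.Sum using (_⊎_)
open import Relation.Nullary using (¬_; yes; no)
open import Relation.Binary.PropositionalEquality using (_≡_; _≢_; sym)
open import Relation.Binary.Construct.Closure.ReflexiveTransitive using (Star)
open import Function using (_∘_)
open import Function.Definitions using (Injective)

Digraph : ℕ → Set
Digraph n = Fin n → Fin n → Bool

Arc : ∀ {n} → Digraph n → Fin n → Fin n → Set
Arc D u v = D u v ≡ true

Reach : ∀ {n} → Digraph n → Fin n → Fin n → Set
Reach D = Star (Arc D)

StronglyConnected : ∀ {n} → Digraph n → Set
StronglyConnected D = ∀ u v → Reach D u v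

WithoutArc : ∀ {n} → Digraph n → Fin n → Fin n → Fin n → Fin n → Set
WithoutArc D u v x y = Arc D x y × ¬ (x ≡ u × y ≡ v)

TransitiveArc : ∀ {n} → Digraph n → Fin n → Fin n → Set
TransitiveArc D u v = Arc D u v × Star (WithoutArc D u v) u v

MinimalStrong : ∀ {n} → Digraph n → Set
MinimalStrong D = StronglyConnected D × (∀ u v → ¬ TransitiveArc D u v)

next : ∀ {q} → Fin q → Fin q
next {suc m} i with toℕ i ℕ.≟ m
... | yes _ = zero
... | no ne = suc (lower₁ i (ne ∘ sym))

-- c : Fin q → Fin n lists the vertices of a directed cycle c 0 → c 1 → … → c (q-1) → c 0 in D
IsDirectedCycle : ∀ {n q} → Digraph n → (Fin q → Fin n) → Set
IsDirectedCycle D c = Injective _≡_ _≡_ c × (∀ i → Arc D (c i) (c (next i)))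

CycleArc : ∀ {n q} → (Fin q → Fin n) → Fin n → Fin n → Set
CycleArc {q = q} c x y = Σ (Fin q) λ i → x ≡ c i × y ≡ c (next i)

ArcMinusCycle : ∀ {n q} → Digraph n → (Fin q → Fin n) → Fin n → Fin n → Set
ArcMinusCycle D c x y = Arc D x y × ¬ CycleArc c x y

SameComp : ∀ {n q} → Digraph n → (Fin q → Fin n) → Fin n → Fin n → Set
SameComp D c x y = Star (ArcMinusCycle D c) x y × Star (ArcMinusCycle D c) y x

CyclicOrder4 : ∀ {q} → Fin q → Fin q → Fin q → Fin q → Set
CyclicOrder4 a b c d =
  (a < b × b < c × c < d) ⊎ (b < c × c < d × d < a) ⊎
  (c < d × d < a × a < b) ⊎ (d < a × a < b × b < c)

{-# OPTIONS --safe #-}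
-- Suppose the cycle arc c k → c (k+1) leads from S₁ to S₂. The cyclic order i₁, j₁, i₂, j₂ splits
-- the cycle into the arc-disjoint segments i₁ → j₁ and i₂ → j₂ (j₁ → i₂ and j₂ → i₁ for an arc
-- from S₂ to S₁), so one of them does not traverse the arc at k. Going inside D' from c k to the
-- start of that segment, along it, and inside D' from its end to c (k+1) gives a second
-- c k → c (k+1) path: the arc is transitive, contradicting minimality.
module Submission where

open import Defs
open import Data.Nat as ℕ using (_≥_; zero; suc; _+_; _∸_; z≤n; s≤s)
import Data.Nat.Properties as ℕ
open import Data.Fin using (Fin; zero; toℕ; fromℕ; _≤_; _<_)
open import Data.Fin.Properties
  using (toℕ-injective; toℕ-lower₁; toℕ-fromℕ; toℕ≤pred[n]; ≤fromℕ; <⇒≢; _≤?_; _<?_)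
open import Data.Product using (_×_; _,_; proj₁; proj₂)
open import Data.Sum using (_⊎_; inj₁; inj₂; [_,_]; swap)
open import Function using (_∘_; id)
open import Relation.Nullary using (¬_; yes; no; contradiction)
open import Relation.Binary.PropositionalEquality
  using (_≡_; _≢_; refl; sym; trans; cong; subst; ≢-sym; module ≡-Reasoning)
open import Relation.Binary.Construct.Closure.ReflexiveTransitive
  using (Star; ε; _◅_; _◅◅_; gmap; map)

toℕ-next-< : ∀ {m} {i j : Fin (suc m)} → i < j → toℕ (next i) ≡ suc (toℕ i)
toℕ-next-< {m} {i} {j} i<j with toℕ i ℕ.≟ m
... | yes i≡m = contradiction i≡m (ℕ.<⇒≢ (ℕ.<-≤-trans i<j (toℕ≤pred[n] j)))
... | no i≢m  = cong suc (toℕ-lower₁ i (i≢m ∘ sym))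

next-fromℕ : ∀ m → next (fromℕ m) ≡ zero
next-fromℕ m with toℕ (fromℕ m) ℕ.≟ m
... | yes _   = refl
... | no ≢m   = contradiction (toℕ-fromℕ m) ≢m

-- The arcs of the cycle traversed from position a to position b are those leaving a, …, b-1,
-- wrapping around past the last position when b < a; none of them leaves k.
SegmentAvoids : ∀ {q} → Fin q → Fin q → Fin q → Set
SegmentAvoids a b k = (a ≤ b × (k < a ⊎ b ≤ k)) ⊎ (b ≤ k × k < a)

module _ {q} {a b c d : Fin q} (a<b : a < b) (b<c : b < c) (c<d : c < d) (k : Fin q) where

  first-or-third-avoids : SegmentAvoids a b k ⊎ SegmentAvoids c d k
  first-or-third-avoids with b ≤? k
  ... | yes b≤k = inj₁ (inj₁ (ℕ.<⇒≤ a<b , inj₂ b≤k))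
  ... | no  b≰k = inj₂ (inj₁ (ℕ.<⇒≤ c<d , inj₁ (ℕ.<-trans (ℕ.≰⇒> b≰k) b<c)))

  second-or-fourth-avoids : SegmentAvoids b c k ⊎ SegmentAvoids d a k
  second-or-fourth-avoids with k <? b | c ≤? k
  ... | yes k<b | _       = inj₁ (inj₁ (ℕ.<⇒≤ b<c , inj₁ k<b))
  ... | no  _   | yes c≤k = inj₁ (inj₁ (ℕ.<⇒≤ b<c , inj₂ c≤k))
  ... | no  k≮b | no  c≰k =
    inj₂ (inj₂ (ℕ.<⇒≤ (ℕ.<-≤-trans a<b (ℕ.≮⇒≥ k≮b)) , ℕ.<-trans (ℕ.≰⇒> c≰k) c<d))

opposite-segments-avoid : ∀ {q} {a b c d : Fin q} → CyclicOrder4 a b c d →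
                          ∀ k → SegmentAvoids a b k ⊎ SegmentAvoids c d k
opposite-segments-avoid (inj₁ (a<b , b<c , c<d)) k = first-or-third-avoids a<b b<c c<d k
opposite-segments-avoid (inj₂ (inj₁ (b<c , c<d , d<a))) k =
  swap (second-or-fourth-avoids b<c c<d d<a k)
opposite-segments-avoid (inj₂ (inj₂ (inj₁ (c<d , d<a , a<b)))) k =
  swap (first-or-third-avoids c<d d<a a<b k)
opposite-segments-avoid (inj₂ (inj₂ (inj₂ (d<a , a<b , b<c)))) k =
  second-or-fourth-avoids d<a a<b b<c k

cyclicOrder4-rotate : ∀ {q} {a b c d : Fin q} → CyclicOrder4 a b c d → CyclicOrder4 b c d a
cyclicOrder4-rotate (inj₁ abcd)               = inj₂ (inj₂ (inj₂ abcd))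
cyclicOrder4-rotate (inj₂ (inj₁ bcda))        = inj₁ bcda
cyclicOrder4-rotate (inj₂ (inj₂ (inj₁ cdab))) = inj₂ (inj₁ cdab)
cyclicOrder4-rotate (inj₂ (inj₂ (inj₂ dabc))) = inj₂ (inj₂ (inj₁ dabc))

private
  after : ∀ {q} {k a i : Fin q} → k < a → a ≤ i → i ≢ k
  after k<a a≤i = ≢-sym (<⇒≢ (ℕ.<-≤-trans k<a a≤i))

  before : ∀ {q} {k b i : Fin q} → i < b → b ≤ k → i ≢ k
  before i<b b≤k = <⇒≢ (ℕ.<-≤-trans i<b b≤k)

module _ {m ℓ} {R : Fin (suc m) → Fin (suc m) → Set ℓ} where

  ascending-walk : ∀ {a b} → a ≤ b → (∀ {i} → a ≤ i → i < b → R i (next i)) → Star R a b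
  ascending-walk {a} {b} a≤b = walk (toℕ b ∸ toℕ a) (ℕ.m+[n∸m]≡n a≤b)
    where
    walk : ∀ d {a} → toℕ a + d ≡ toℕ b → (∀ {i} → a ≤ i → i < b → R i (next i)) → Star R a b
    walk zero {a} a+0≡b _ =
      subst (Star R a) (toℕ-injective (trans (sym (ℕ.+-identityʳ (toℕ a))) a+0≡b)) ε
    walk (suc d) {a} a+1+d≡b step = step ℕ.≤-refl a<b ◅ walk d next-a+d≡b step-after-a
      where
      a<b : a < b
      a<b = subst (toℕ a ℕ.<_) a+1+d≡b (ℕ.m<m+n (toℕ a) ℕ.z<s)
      next-a+d≡b : toℕ (next a) + d ≡ toℕ b
      next-a+d≡b = begin
        toℕ (next a) + d  ≡⟨ cong (_+ d) (toℕ-next-< a<b) ⟩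
        suc (toℕ a) + d   ≡⟨ ℕ.+-suc (toℕ a) d ⟨
        toℕ a + suc d     ≡⟨ a+1+d≡b ⟩
        toℕ b             ∎
        where open ≡-Reasoning
      step-after-a : ∀ {i} → next a ≤ i → i < b → R i (next i)
      step-after-a {i} next-a≤i = step (ℕ.<⇒≤ (subst (ℕ._≤ toℕ i) (toℕ-next-< a<b) next-a≤i))

  segment-walk : ∀ {k a b} → (∀ {i} → i ≢ k → R i (next i)) → SegmentAvoids a b k → Star R a b
  segment-walk step (inj₁ (a≤b , inj₁ k<a)) = ascending-walk a≤b (λ a≤i _ → step (after k<a a≤i))
  segment-walk step (inj₁ (a≤b , inj₂ b≤k)) = ascending-walk a≤b (λ _ i<b → step (before i<b b≤k))
  segment-walk step (inj₂ (b≤k , k<a)) =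
    ascending-walk (≤fromℕ _) (λ a≤i _ → step (after k<a a≤i))
    ◅◅ subst (R (fromℕ m)) (next-fromℕ m) (step (after k<a (≤fromℕ _)))
    ◅ ascending-walk z≤n (λ _ i<b → step (before i<b b≤k))

module _ {n m} {D : Digraph n} {c : Fin (suc m) → Fin n} where

  sameComp-path : ∀ {r x y} → SameComp D c r x → SameComp D c r y → Star (ArcMinusCycle D c) x y
  sameComp-path r~x r~y = proj₂ r~x ◅◅ proj₁ r~y

  cycle-arc-transitive : IsDirectedCycle D c → ∀ {k p p'} → SegmentAvoids p p' k →
                         Star (ArcMinusCycle D c) (c k) (c p) →
                         Star (ArcMinusCycle D c) (c p') (c (next k)) →
                         TransitiveArc D (c k) (c (next k))
  cycle-arc-transitive (c-injective , c-arc) {k} avoids k⇝p p'⇝next-k =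
    c-arc k , avoid-k k⇝p ◅◅ gmap c id (segment-walk step avoids) ◅◅ avoid-k p'⇝next-k
    where
    Avoiding : Fin n → Fin n → Set
    Avoiding = WithoutArc D (c k) (c (next k))

    avoid-k : ∀ {x y} → Star (ArcMinusCycle D c) x y → Star Avoiding x y
    avoid-k = map λ (xy , not-cycle) → xy , λ (x≡ck , y≡c[next-k]) → not-cycle (k , x≡ck , y≡c[next-k])

    step : ∀ {i} → i ≢ k → Avoiding (c i) (c (next i))
    step i≢k = c-arc _ , λ (ci≡ck , _) → i≢k (c-injective ci≡ck)

lemma3 : ∀ {n q} (D : Digraph n) → MinimalStrong D → q ≥ 2 →
         (c : Fin q → Fin n) → IsDirectedCycle D c →
         (r₁ r₂ : Fin n) → ¬ SameComp D c r₁ r₂ →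
         (i₁ j₁ i₂ j₂ : Fin q) → CyclicOrder4 i₁ j₁ i₂ j₂ →
         SameComp D c r₁ (c i₁) → SameComp D c r₁ (c i₂) →
         SameComp D c r₂ (c j₁) → SameComp D c r₂ (c j₂) →
         (k : Fin q) →
         ¬ (SameComp D c r₁ (c k) × SameComp D c r₂ (c (next k))) ×
         ¬ (SameComp D c r₂ (c k) × SameComp D c r₁ (c (next k)))
lemma3 D (_ , no-transitive) (s≤s _) c cycle r₁ r₂ _ i₁ j₁ i₂ j₂ order r₁i₁ r₁i₂ r₂j₁ r₂j₂ k =
  [ no-cut-arc r₁i₁ r₂j₁ , no-cut-arc r₁i₂ r₂j₂ ] (opposite-segments-avoid order k) ,
  [ no-cut-arc r₂j₁ r₁i₂ , no-cut-arc r₂j₂ r₁i₁ ] (opposite-segments-avoid (cyclicOrder4-rotate order) k)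
  where
  no-cut-arc : ∀ {s t p p'} → SameComp D c s (c p) → SameComp D c t (c p') → SegmentAvoids p p' k →
               ¬ (SameComp D c s (c k) × SameComp D c t (c (next k)))
  no-cut-arc s~p t~p' avoids (s~k , t~next-k) = no-transitive _ _
    (cycle-arc-transitive cycle avoids (sameComp-path s~k s~p) (sameComp-path t~p' t~next-k))
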